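{- Let $p\geq 5$ be a prime number and $n,k$ positive integers. Then \begin{align*} \binom{np-1}{4k}_{3}&\equiv 1-np\left(\tfrac{3}{4}H_{k}+\sum_{j=0}^{k-1}\frac{1}{4j+3}\right) \pmod{p^{2}} &&\text{if } 4k\leq p-1,\\ \binom{np-1}{4k+1}_{3}&\equiv -1+np\left(\tfrac{3}{4}H_{k}+\sum_{j=0}^{k}\frac{1}{4j+1}\right) \pmod{p^{2}} &&\text{if } 4k+1\leq p-1,\\ \binom{np-1}{4k+2}_{3}&\equiv np\left(\sum_{j=0}^{k}\frac{1}{4j+2}-\sum_{j=0}^{k}\frac{1}{4j+1}\right) \pmod{p^{2}} &&\text{if } 4k+2\leq p-1,\\ \binom{np-1}{4k+3}_{3}&\equiv np\left(\sum_{j=0}^{k}\frac{1}{4j+3}-\sum_{j=0}^{k}\frac{1}{4j+2}\right) \pmod{p^{2}} &&\text{if } 4k+3\leq p-1. \end{align*}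
   Context: For a nonnegative integer $m$, the quadrinomial coefficients $\binom{m}{k}_{3}$ are defined by $(1+x+x^2+x^3)^{m}=\sum_{k=0}^{3m}\binom{m}{k}_{3}x^{k}$. $H_0=0$ and $H_m=1+\frac12+\cdots+\frac1m$ are the harmonic numbers. Congruences between rational numbers whose denominators are coprime to $p$ are understood in the ring of $p$-integral rationals. -}

module Defs where

open import Data.Nat as ℕ using (ℕ; zero; suc)
open import Data.Integer as ℤ using (ℤ)
open import Data.List using (List; []; _∷_)
open import Data.Rational as ℚ using (ℚ; _-_; _+_; _*_; 1ℚ; 0ℚ)
open import Data.Nat.Divisibility using (_∣_)
open import Relation.Nullary using (¬_)
open import Data.Product using (_×_)

-- Polynomials with natural coefficients as coefficient lists (lowest degree first).
Poly : Set
Poly = List ℕ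

_⊕_ : Poly → Poly → Poly
[] ⊕ q = q
(a ∷ p) ⊕ [] = a ∷ p
(a ∷ p) ⊕ (b ∷ q) = (a ℕ.+ b) ∷ (p ⊕ q)

scale : ℕ → Poly → Poly
scale c [] = []
scale c (a ∷ p) = (c ℕ.* a) ∷ scale c p

_⊗_ : Poly → Poly → Poly
[] ⊗ q = []
(a ∷ p) ⊗ q = scale a q ⊕ (0 ∷ (p ⊗ q))

_^ᵖ_ : Poly → ℕ → Poly
p ^ᵖ zero = 1 ∷ []
p ^ᵖ suc m = p ⊗ (p ^ᵖ m)

coeff : Poly → ℕ → ℕ
coeff [] k = 0
coeff (a ∷ p) zero = a
coeff (a ∷ p) (suc k) = coeff p k

quad : Poly
quad = 1 ∷ 1 ∷ 1 ∷ 1 ∷ []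

quadBinom : ℕ → ℕ → ℕ
quadBinom m k = coeff (quad ^ᵖ m) k

-- the rational number 1/(n+1)  (so inv 0 = 1, inv 1 = 1/2, ...)
inv : ℕ → ℚ
inv n = ℤ.+ 1 ℚ./ suc n

sumTo : ℕ → (ℕ → ℚ) → ℚ
sumTo zero f = 0ℚ
sumTo (suc n) f = sumTo n f + f n

H : ℕ → ℚ
H m = sumTo m inv

fromℕ : ℕ → ℚ
fromℕ n = ℤ.+ n ℚ./ 1

fromℤ : ℤ → ℚ
fromℤ z = z ℚ./ 1

-- a ≡ b (mod m) for a prime p and modulus m = p^e, in the ring of p-integral
-- rationals: a - b = u/v in lowest terms with m ∣ u and p ∤ v.
CongMod : (p m : ℕ) → ℚ → ℚ → Set
CongMod p m a b =
  (m ∣ ℤ.∣ ℚ.↥ (a - b) ∣) × ¬ (p ∣ ℤ.∣ ℚ.↧ (a - b) ∣)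

threeQuarters : ℚ
threeQuarters = ℤ.+ 3 ℚ./ 4

{-# OPTIONS --safe #-}
-- Let a_r be the coefficient of x^r in f = (1+x+x²+x³)^m and N = m + 1. Comparing coefficients in
-- (1+x+x²+x³) f′ = m (1+2x+3x²) f gives
--   r a_r = (N − r) a_(r−1) + (2N − r) a_(r−2) + (3N − r) a_(r−3).
-- The claimed value T_r = β_r + N γ_r, with β periodic of pattern 1, −1, 0, 0 and γ the harmonic
-- expressions of the statement, satisfies the same recurrence up to N² (γ_(r−1) + 2γ_(r−2) + 3γ_(r−3)):
-- four consecutive β sum to 0, and r times four consecutive γ, a telescoping sum, equals
-- β_(r−1) + 2β_(r−2) + 3β_(r−3). If p ∣ N then p² ∣ N², and for r < p the factor r is a p-adic unit,
-- so a_r ≡ T_r (mod p²) follows by induction on r, starting from a_r = T_r for r ≤ 0.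
module Submission where

open import Defs
open import Data.Nat as ℕ using (ℕ; zero; suc; _<_; NonZero)
open import Data.Nat.Properties using (<-trans; n<1+n)
open import Data.Nat.Primality using (Prime)
open import Data.Product using (_×_; _,_; proj₂)
open import Relation.Binary.PropositionalEquality
open import Tactic.RingSolver using (solve-∀)
open import Data.Nat.Tactic.RingSolver renaming (solve-∀ to ℕ-solve-∀)

module RationalArithmetic where
  open import Data.Integer as ℤ using (+_)
  open import Data.Integer.Properties using (pos-+; pos-*)
  open import Data.Integer.Tactic.RingSolver renaming (solve-∀ to ℤ-solve-∀)
  open import Data.Rational using (ℚ; 0ℚ; 1ℚ; _+_; _*_; toℚᵘ)
  open import Data.Rational.Properties
    using (+-*-commutativeRing; _≟_; *-comm; *-assoc; *-identityˡ; toℚᵘ-injective; toℚᵘ-fromℚᵘ; toℚᵘ-homo-+; toℚᵘ-homo-*)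
  import Data.Rational.Unnormalised as ℚᵘ
  import Data.Rational.Unnormalised.Properties as ℚᵘ
  open import Level using (0ℓ)
  open import Relation.Nullary.Decidable using (dec⇒maybe)
  open import Tactic.RingSolver.Core.AlmostCommutativeRing using (AlmostCommutativeRing; fromCommutativeRing)

  ℚ-ring : AlmostCommutativeRing 0ℓ 0ℓ
  ℚ-ring = fromCommutativeRing +-*-commutativeRing (λ x → dec⇒maybe (0ℚ ≟ x))

  toℚᵘ-fromℕ : ∀ n → toℚᵘ (fromℕ n) ℚᵘ.≃ ℚᵘ.mkℚᵘ (+ n) 0
  toℚᵘ-fromℕ n = toℚᵘ-fromℚᵘ (ℚᵘ.mkℚᵘ (+ n) 0)

  fromℕ-+ : ∀ a b → fromℕ (a ℕ.+ b) ≡ fromℕ a + fromℕ b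
  fromℕ-+ a b = toℚᵘ-injective (begin
    toℚᵘ (fromℕ (a ℕ.+ b))               ≈⟨ toℚᵘ-fromℕ (a ℕ.+ b) ⟩
    ℚᵘ.mkℚᵘ (+ (a ℕ.+ b)) 0              ≈⟨ ℚᵘ.*≡* (trans (cong (ℤ._* + 1) (pos-+ a b)) (cross-multiplied (+ a) (+ b))) ⟩
    ℚᵘ.mkℚᵘ (+ a) 0 ℚᵘ.+ ℚᵘ.mkℚᵘ (+ b) 0 ≈⟨ ℚᵘ.+-cong (toℚᵘ-fromℕ a) (toℚᵘ-fromℕ b) ⟨
    toℚᵘ (fromℕ a) ℚᵘ.+ toℚᵘ (fromℕ b)   ≈⟨ toℚᵘ-homo-+ (fromℕ a) (fromℕ b) ⟨
    toℚᵘ (fromℕ a + fromℕ b)             ∎)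
    where
    open ℚᵘ.≃-Reasoning
    cross-multiplied : ∀ x y → (x ℤ.+ y) ℤ.* + 1 ≡ (x ℤ.* + 1 ℤ.+ y ℤ.* + 1) ℤ.* + 1
    cross-multiplied = ℤ-solve-∀

  fromℕ-* : ∀ a b → fromℕ (a ℕ.* b) ≡ fromℕ a * fromℕ b
  fromℕ-* a b = toℚᵘ-injective (begin
    toℚᵘ (fromℕ (a ℕ.* b))               ≈⟨ toℚᵘ-fromℕ (a ℕ.* b) ⟩
    ℚᵘ.mkℚᵘ (+ (a ℕ.* b)) 0              ≈⟨ ℚᵘ.*≡* (cong (ℤ._* + 1) (pos-* a b)) ⟩
    ℚᵘ.mkℚᵘ (+ a) 0 ℚᵘ.* ℚᵘ.mkℚᵘ (+ b) 0 ≈⟨ ℚᵘ.*-cong (toℚᵘ-fromℕ a) (toℚᵘ-fromℕ b) ⟨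
    toℚᵘ (fromℕ a) ℚᵘ.* toℚᵘ (fromℕ b)   ≈⟨ toℚᵘ-homo-* (fromℕ a) (fromℕ b) ⟨
    toℚᵘ (fromℕ a * fromℕ b)             ∎)
    where open ℚᵘ.≃-Reasoning

  inv-inverseˡ : ∀ n → inv n * fromℕ (suc n) ≡ 1ℚ
  inv-inverseˡ n = toℚᵘ-injective (begin
    toℚᵘ (inv n * fromℕ (suc n))                     ≈⟨ toℚᵘ-homo-* (inv n) (fromℕ (suc n)) ⟩
    toℚᵘ (inv n) ℚᵘ.* toℚᵘ (fromℕ (suc n))           ≈⟨ ℚᵘ.*-cong (toℚᵘ-fromℚᵘ (ℚᵘ.mkℚᵘ (+ 1) n)) (toℚᵘ-fromℕ (suc n)) ⟩
    ℚᵘ.mkℚᵘ (+ 1) n ℚᵘ.* ℚᵘ.mkℚᵘ (+ suc n) 0       ≈⟨ ℚᵘ.*≡* (cong +_ (cross-multiplied n)) ⟩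
    toℚᵘ 1ℚ                                          ∎)
    where
    open ℚᵘ.≃-Reasoning
    cross-multiplied : ∀ n → (1 ℕ.* suc n) ℕ.* 1 ≡ 1 ℕ.* suc (n ℕ.* 1)
    cross-multiplied = ℕ-solve-∀

  fromℕ*inv≡1 : ∀ {a} b → a ≡ suc b → fromℕ a * inv b ≡ 1ℚ
  fromℕ*inv≡1 b refl = trans (*-comm (fromℕ (suc b)) (inv b)) (inv-inverseˡ b)

  inv-cancelˡ : ∀ n x → inv n * (fromℕ (suc n) * x) ≡ x
  inv-cancelˡ n x =
    trans (sym (*-assoc (inv n) (fromℕ (suc n)) x)) (trans (cong (_* x) (inv-inverseˡ n)) (*-identityˡ x))

module QuadrinomialRecurrence where
  open import Data.Nat.Properties using (+-identityʳ; *-identityˡ)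
  import Data.Nat.Properties as ℕ
  open import Data.List using ([]; _∷_; replicate)
  open import Data.Rational using (ℚ; 0ℚ; _+_; _*_; _-_; -_)
  open import Data.Rational.Properties using (+-assoc; *-zeroʳ)
  open RationalArithmetic

  coeff-⊕ : ∀ f g i → coeff (f ⊕ g) i ≡ coeff f i ℕ.+ coeff g i
  coeff-⊕ []      g       i       = refl
  coeff-⊕ (a ∷ f) []      i       = sym (+-identityʳ _)
  coeff-⊕ (a ∷ f) (b ∷ g) zero    = refl
  coeff-⊕ (a ∷ f) (b ∷ g) (suc i) = coeff-⊕ f g i

  coeff-scale : ∀ c f i → coeff (scale c f) i ≡ c ℕ.* coeff f i
  coeff-scale c []      i       = sym (ℕ.*-zeroʳ c)
  coeff-scale c (a ∷ f) zero    = refl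
  coeff-scale c (a ∷ f) (suc i) = coeff-scale c f i

  coeff-replicate-0 : ∀ n i → coeff (replicate n 0) i ≡ 0
  coeff-replicate-0 zero    i       = refl
  coeff-replicate-0 (suc n) zero    = refl
  coeff-replicate-0 (suc n) (suc i) = coeff-replicate-0 n i

  coeff-quad-⊗ : ∀ f i → coeff (quad ⊗ f) i ≡
    coeff f i ℕ.+ (coeff (0 ∷ f) i ℕ.+ (coeff (0 ∷ 0 ∷ f) i ℕ.+ coeff (0 ∷ 0 ∷ 0 ∷ f) i))
  coeff-quad-⊗ f i =
    trans (coeff-scale1-⊕ f (0 ∷ ((1 ∷ 1 ∷ 1 ∷ []) ⊗ f))) (cong (coeff f i ℕ.+_)
    (trans (coeff-scale1-⊕ (0 ∷ f) (0 ∷ 0 ∷ ((1 ∷ 1 ∷ []) ⊗ f))) (cong (coeff (0 ∷ f) i ℕ.+_)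
    (trans (coeff-scale1-⊕ (0 ∷ 0 ∷ f) (0 ∷ 0 ∷ 0 ∷ ((1 ∷ []) ⊗ f))) (cong (coeff (0 ∷ 0 ∷ f) i ℕ.+_)
    (trans (coeff-scale1-⊕ (0 ∷ 0 ∷ 0 ∷ f) (replicate 4 0))
           (trans (cong (coeff (0 ∷ 0 ∷ 0 ∷ f) i ℕ.+_) (coeff-replicate-0 4 i)) (+-identityʳ _))))))))
    where
    coeff-scale1-⊕ : ∀ g h → coeff (scale 1 g ⊕ h) i ≡ coeff g i ℕ.+ coeff h i
    coeff-scale1-⊕ g h = trans (coeff-⊕ (scale 1 g) h i) (cong (ℕ._+ coeff h i) (trans (coeff-scale 1 g i) (*-identityˡ _)))

  shift₆ : Poly → Poly
  shift₆ f = 0 ∷ 0 ∷ 0 ∷ 0 ∷ 0 ∷ 0 ∷ f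

  coeff-shift₆-quad-⊗ : ∀ f r → coeff (shift₆ (quad ⊗ f)) (3 ℕ.+ r) ≡
    coeff (shift₆ f) (3 ℕ.+ r) ℕ.+ (coeff (shift₆ f) (2 ℕ.+ r) ℕ.+ (coeff (shift₆ f) (1 ℕ.+ r) ℕ.+ coeff (shift₆ f) r))
  coeff-shift₆-quad-⊗ f 0 = refl
  coeff-shift₆-quad-⊗ f 1 = refl
  coeff-shift₆-quad-⊗ f 2 = refl
  coeff-shift₆-quad-⊗ f (suc (suc (suc r))) = coeff-quad-⊗ f r

  -- The six leading zeros make the recurrences below hold at every index, the lowest ones vacuously.
  quadBinom₆ : ℕ → ℕ → ℚ
  quadBinom₆ m j = fromℕ (coeff (shift₆ (quad ^ᵖ m)) j)

  -- (quad· u) i is the coefficient of x^(3+i) in (1+x+x²+x³) Σ u_j x^j, and (quad′· u) i that of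
  -- x^(2+i) in (1+2x+3x²) Σ u_j x^j.
  quad·_ : (ℕ → ℚ) → ℕ → ℚ
  (quad· u) i = u (3 ℕ.+ i) + u (2 ℕ.+ i) + u (1 ℕ.+ i) + u i

  quad′·_ : (ℕ → ℚ) → ℕ → ℚ
  (quad′· u) i = u (2 ℕ.+ i) + fromℕ 2 * u (1 ℕ.+ i) + fromℕ 3 * u i

  quadBinom₆-suc : ∀ m i → quadBinom₆ (suc m) (3 ℕ.+ i) ≡ (quad· quadBinom₆ m) i
  quadBinom₆-suc m i = trans (cong fromℕ (coeff-shift₆-quad-⊗ (quad ^ᵖ m) i))
    (fromℕ-+₄ (c (3 ℕ.+ i)) (c (2 ℕ.+ i)) (c (1 ℕ.+ i)) (c i))
    where
    c : ℕ → ℕ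
    c = coeff (shift₆ (quad ^ᵖ m))
    fromℕ-+₄ : ∀ a b c d → fromℕ (a ℕ.+ (b ℕ.+ (c ℕ.+ d))) ≡ fromℕ a + fromℕ b + fromℕ c + fromℕ d
    fromℕ-+₄ a b c d = trans (cong fromℕ (reassoc a b c d))
      (trans (fromℕ-+ (a ℕ.+ b ℕ.+ c) d) (cong (_+ fromℕ d) (trans (fromℕ-+ (a ℕ.+ b) c) (cong (_+ fromℕ c) (fromℕ-+ a b)))))
      where
      reassoc : ∀ a b c d → a ℕ.+ (b ℕ.+ (c ℕ.+ d)) ≡ a ℕ.+ b ℕ.+ c ℕ.+ d
      reassoc = ℕ-solve-∀

  -- With N = m + 1 and S = r − 3, recurrenceDefect N S (quadBinom₆ m) r is the coefficient of x^(r−4)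
  -- in (1+x+x²+x³) f′ − m (1+2x+3x²) f for f = (1+x+x²+x³)^m.
  recurrenceDefect : (N S : ℚ) → (ℕ → ℚ) → ℕ → ℚ
  recurrenceDefect N S u j =
    S * u (3 ℕ.+ j) - (N - S) * u (2 ℕ.+ j) - (fromℕ 2 * N - S) * u (1 ℕ.+ j) - (fromℕ 3 * N - S) * u j

  recurrenceDefect-cong : ∀ N S {u v} j → (∀ i → u i ≡ v i) → recurrenceDefect N S u j ≡ recurrenceDefect N S v j
  recurrenceDefect-cong N S j u≗v =
    cong₂ _-_ (cong₂ _-_ (cong₂ (λ a b → S * a - (N - S) * b) (u≗v (3 ℕ.+ j)) (u≗v (2 ℕ.+ j)))
                         (cong ((fromℕ 2 * N - S) *_) (u≗v (1 ℕ.+ j))))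
              (cong ((fromℕ 3 * N - S) *_) (u≗v j))

  recurrenceDefect-0 : ∀ N S j → recurrenceDefect N S (λ _ → 0ℚ) j ≡ 0ℚ
  recurrenceDefect-0 N S j =
    cong₂ _-_ (cong₂ _-_ (cong₂ _-_ (*-zeroʳ S) (*-zeroʳ (N - S))) (*-zeroʳ (fromℕ 2 * N - S))) (*-zeroʳ (fromℕ 3 * N - S))

  -- With q = 1+x+x²+x³: q (q f)′ − (m+1) q′ (q f) = q (q f′ − m q′ f).
  recurrenceDefect-quad· : ∀ N S u j →
    recurrenceDefect (fromℕ 1 + N) (fromℕ 3 + S) (quad· u) j ≡
      recurrenceDefect N (fromℕ 3 + S) u (3 ℕ.+ j) + recurrenceDefect N (fromℕ 2 + S) u (2 ℕ.+ j)
      + recurrenceDefect N (fromℕ 1 + S) u (1 ℕ.+ j) + recurrenceDefect N S u j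
  recurrenceDefect-quad· N S u j =
    identity N S (u j) (u (1 ℕ.+ j)) (u (2 ℕ.+ j)) (u (3 ℕ.+ j)) (u (4 ℕ.+ j)) (u (5 ℕ.+ j)) (u (6 ℕ.+ j))
    where
    identity : ∀ N S a₀ a₁ a₂ a₃ a₄ a₅ a₆ →
      let F = λ N S u₃ u₂ u₁ u₀ → S * u₃ - (N - S) * u₂ - (fromℕ 2 * N - S) * u₁ - (fromℕ 3 * N - S) * u₀ in
      F (fromℕ 1 + N) (fromℕ 3 + S) (a₆ + a₅ + a₄ + a₃) (a₅ + a₄ + a₃ + a₂) (a₄ + a₃ + a₂ + a₁) (a₃ + a₂ + a₁ + a₀)
      ≡ F N (fromℕ 3 + S) a₆ a₅ a₄ a₃ + F N (fromℕ 2 + S) a₅ a₄ a₃ a₂ + F N (fromℕ 1 + S) a₄ a₃ a₂ a₁ + F N S a₃ a₂ a₁ a₀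
    identity = solve-∀ ℚ-ring

  quadBinom₆-recurrence : ∀ m r → recurrenceDefect (fromℕ (suc m)) (fromℕ r - fromℕ 3) (quadBinom₆ m) r ≡ 0ℚ
  quadBinom₆-recurrence zero 0 = refl
  quadBinom₆-recurrence zero 1 = refl
  quadBinom₆-recurrence zero 2 = refl
  quadBinom₆-recurrence zero 3 = refl
  quadBinom₆-recurrence zero 4 = refl
  quadBinom₆-recurrence zero 5 = refl
  quadBinom₆-recurrence zero 6 = refl
  quadBinom₆-recurrence zero r@(suc (suc (suc (suc (suc (suc (suc _))))))) = recurrenceDefect-0 (fromℕ 1) (fromℕ r - fromℕ 3) r
  quadBinom₆-recurrence (suc m) 0 = recurrenceDefect-0 (fromℕ (2 ℕ.+ m)) (fromℕ 0 - fromℕ 3) 0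
  quadBinom₆-recurrence (suc m) 1 = recurrenceDefect-0 (fromℕ (2 ℕ.+ m)) (fromℕ 1 - fromℕ 3) 1
  quadBinom₆-recurrence (suc m) 2 = recurrenceDefect-0 (fromℕ (2 ℕ.+ m)) (fromℕ 2 - fromℕ 3) 2
  quadBinom₆-recurrence (suc m) (suc (suc (suc r))) = begin
    recurrenceDefect (fromℕ (2 ℕ.+ m)) (fromℕ (3 ℕ.+ r) - fromℕ 3) (quadBinom₆ (suc m)) (3 ℕ.+ r)
      ≡⟨ cong₂ (λ N S → recurrenceDefect N S (quadBinom₆ (suc m)) (3 ℕ.+ r)) (fromℕ-+ 1 (suc m)) (index 3) ⟩
    recurrenceDefect (fromℕ 1 + M) (fromℕ 3 + S) (quadBinom₆ (suc m)) (3 ℕ.+ r)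
      ≡⟨ recurrenceDefect-cong (fromℕ 1 + M) (fromℕ 3 + S) r (quadBinom₆-suc m) ⟩
    recurrenceDefect (fromℕ 1 + M) (fromℕ 3 + S) (quad· (quadBinom₆ m)) r
      ≡⟨ recurrenceDefect-quad· M S (quadBinom₆ m) r ⟩
    recurrenceDefect M (fromℕ 3 + S) u (3 ℕ.+ r) + recurrenceDefect M (fromℕ 2 + S) u (2 ℕ.+ r)
      + recurrenceDefect M (fromℕ 1 + S) u (1 ℕ.+ r) + recurrenceDefect M S u r
      ≡⟨ cong₂ _+_ (cong₂ _+_ (cong₂ _+_ (shifted 3) (shifted 2)) (shifted 1)) (quadBinom₆-recurrence m r) ⟩
    0ℚ ∎
    where
    open ≡-Reasoning
    M = fromℕ (suc m)
    S = fromℕ r - fromℕ 3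
    u = quadBinom₆ m
    index : ∀ k → fromℕ (k ℕ.+ r) - fromℕ 3 ≡ fromℕ k + S
    index k = trans (cong (_- fromℕ 3) (fromℕ-+ k r)) (+-assoc (fromℕ k) (fromℕ r) (- fromℕ 3))
    shifted : ∀ k → recurrenceDefect M (fromℕ k + S) u (k ℕ.+ r) ≡ 0ℚ
    shifted k = trans (cong (λ S → recurrenceDefect M S u (k ℕ.+ r)) (sym (index k))) (quadBinom₆-recurrence m (k ℕ.+ r))

  deviation-recurrence : ∀ N S (x b g : ℕ → ℚ) j →
    recurrenceDefect N S x j ≡ 0ℚ → (quad· b) j ≡ 0ℚ → S * (quad· g) j ≡ (quad′· b) j →
    let e = λ i → x i - (b i + N * g i) in
    S * e (3 ℕ.+ j) ≡ (N - S) * e (2 ℕ.+ j) + (fromℕ 2 * N - S) * e (1 ℕ.+ j) + (fromℕ 3 * N - S) * e j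
                      + N * N * (quad′· g) j
  deviation-recurrence N S x b g j x-recurrence quad·b≡0 S*quad·g≡quad′·b =
    trans (identity N S (x (3 ℕ.+ j)) (x (2 ℕ.+ j)) (x (1 ℕ.+ j)) (x j) (b (3 ℕ.+ j)) (b (2 ℕ.+ j)) (b (1 ℕ.+ j)) (b j)
                    (g (3 ℕ.+ j)) (g (2 ℕ.+ j)) (g (1 ℕ.+ j)) (g j))
    (trans (cong₃ (λ d w v → R + d - S * w - N * (v - (quad′· b) j)) x-recurrence quad·b≡0 S*quad·g≡quad′·b)
           (cleanup R S N ((quad′· b) j)))
    where
    e : ℕ → ℚ
    e i = x i - (b i + N * g i)
    R : ℚ
    R = (N - S) * e (2 ℕ.+ j) + (fromℕ 2 * N - S) * e (1 ℕ.+ j) + (fromℕ 3 * N - S) * e j + N * N * (quad′· g) j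
    cong₃ : ∀ (f : ℚ → ℚ → ℚ → ℚ) {a a′ b b′ c c′} → a ≡ a′ → b ≡ b′ → c ≡ c′ → f a b c ≡ f a′ b′ c′
    cong₃ f refl refl refl = refl
    identity : ∀ N S x₃ x₂ x₁ x₀ b₃ b₂ b₁ b₀ g₃ g₂ g₁ g₀ →
      let e = λ x b g → x - (b + N * g) in
      S * e x₃ b₃ g₃ ≡
        (N - S) * e x₂ b₂ g₂ + (fromℕ 2 * N - S) * e x₁ b₁ g₁ + (fromℕ 3 * N - S) * e x₀ b₀ g₀
        + N * N * (g₂ + fromℕ 2 * g₁ + fromℕ 3 * g₀)
        + (S * x₃ - (N - S) * x₂ - (fromℕ 2 * N - S) * x₁ - (fromℕ 3 * N - S) * x₀)
        - S * (b₃ + b₂ + b₁ + b₀)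
        - N * (S * (g₃ + g₂ + g₁ + g₀) - (b₂ + fromℕ 2 * b₁ + fromℕ 3 * b₀))
    identity = solve-∀ ℚ-ring
    cleanup : ∀ R S N c → R + 0ℚ - S * 0ℚ - N * (c - c) ≡ R
    cleanup = solve-∀ ℚ-ring

  quadBinom-0 : ∀ m → quadBinom m 0 ≡ 1
  quadBinom-0 zero    = refl
  quadBinom-0 (suc m) = trans (coeff-quad-⊗ (quad ^ᵖ m) 0) (trans (+-identityʳ (quadBinom m 0)) (quadBinom-0 m))

module HarmonicCandidate where
  open import Data.Nat.Properties using (+-suc; +-identityʳ)
  open import Data.Rational using (ℚ; 0ℚ; 1ℚ; _+_; _*_; _-_; -_)
  open RationalArithmetic
  open QuadrinomialRecurrence using (quad·_; quad′·_)

  β : ℕ → ℚ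
  β 0 = 1ℚ
  β 1 = - 1ℚ
  β 2 = 0ℚ
  β 3 = 0ℚ
  β (suc (suc (suc (suc r)))) = β r

  -- σᵢ n = Σ_{j<n} 1/(4j+i+1), recalling inv n = 1/(n+1).
  σ₀ σ₁ σ₂ : ℕ → ℚ
  σ₀ n = sumTo n (λ j → inv (4 ℕ.* j))
  σ₁ n = sumTo n (λ j → inv (4 ℕ.* j ℕ.+ 1))
  σ₂ n = sumTo n (λ j → inv (4 ℕ.* j ℕ.+ 2))

  -- γ k t is the coefficient of N in the candidate at index 4k + t.
  γ : ℕ → ℕ → ℚ
  γ k 0 = - (threeQuarters * H k + σ₂ k)
  γ k 1 = threeQuarters * H k + σ₀ (suc k)
  γ k 2 = σ₁ (suc k) - σ₀ (suc k)
  γ k 3 = σ₂ (suc k) - σ₁ (suc k)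
  γ k (suc (suc (suc (suc t)))) = γ (suc k) t

  β-periodic : ∀ k i → β (4 ℕ.* k ℕ.+ i) ≡ β i
  β-periodic zero    i = refl
  β-periodic (suc k) i = trans (cong β (4* k i)) (β-periodic k i)
    where
    4* : ∀ k i → 4 ℕ.* suc k ℕ.+ i ≡ 4 ℕ.+ (4 ℕ.* k ℕ.+ i)
    4* = ℕ-solve-∀

  γ-shift : ∀ j k i → γ j (4 ℕ.* k ℕ.+ i) ≡ γ (j ℕ.+ k) i
  γ-shift j zero    i = cong (λ l → γ l i) (sym (+-identityʳ j))
  γ-shift j (suc k) i = trans (cong (γ j) (4* k i)) (trans (γ-shift (suc j) k i) (cong (λ l → γ l i) (sym (+-suc j k))))
    where
    4* : ∀ k i → 4 ℕ.* suc k ℕ.+ i ≡ 4 ℕ.+ (4 ℕ.* k ℕ.+ i)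
    4* = ℕ-solve-∀

  quad·β : ∀ t → (quad· β) t ≡ 0ℚ
  quad·β 0 = refl
  quad·β 1 = refl
  quad·β 2 = refl
  quad·β 3 = refl
  quad·β (suc (suc (suc (suc t)))) = quad·β t

  quad·γ : ∀ k t → fromℕ (3 ℕ.+ (4 ℕ.* k ℕ.+ t)) * (quad· γ k) t ≡ (quad′· β) t
  quad·γ k 0 =
    trans (cong (fromℕ (3 ℕ.+ (4 ℕ.* k ℕ.+ 0)) *_)
                (telescope₀ (threeQuarters * H k) (σ₀ (suc k)) (σ₁ (suc k)) (σ₂ k) (inv (4 ℕ.* k ℕ.+ 2))))
          (fromℕ*inv≡1 (4 ℕ.* k ℕ.+ 2) (index k))
    where
    telescope₀ : ∀ h a₀ a₁ a₂ d → (a₂ + d) - a₁ + (a₁ - a₀) + (h + a₀) + - (h + a₂) ≡ d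
    telescope₀ = solve-∀ ℚ-ring
    index : ∀ k → 3 ℕ.+ (4 ℕ.* k ℕ.+ 0) ≡ suc (4 ℕ.* k ℕ.+ 2)
    index = ℕ-solve-∀
  quad·γ k 1 = begin
    fromℕ (3 ℕ.+ (4 ℕ.* k ℕ.+ 1)) * (quad· γ k) 1
      ≡⟨ cong₂ _*_ (trans (cong fromℕ (index k)) (fromℕ-* 4 (suc k)))
                   (telescope₁ threeQuarters (H k) (inv k) (σ₀ (suc k)) (σ₁ (suc k)) (σ₂ (suc k))) ⟩
    fromℕ 4 * fromℕ (suc k) * - (threeQuarters * inv k)
      ≡⟨ regroup (fromℕ 4) (fromℕ (suc k)) threeQuarters (inv k) ⟩
    - (threeQuarters * fromℕ 4) * (inv k * fromℕ (suc k))
      ≡⟨ cong (- (threeQuarters * fromℕ 4) *_) (inv-inverseˡ k) ⟩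
    - (threeQuarters * fromℕ 4) * 1ℚ ∎
    where
    open ≡-Reasoning
    telescope₁ : ∀ c h i a₀ a₁ a₂ → - (c * (h + i) + a₂) + (a₂ - a₁) + (a₁ - a₀) + (c * h + a₀) ≡ - (c * i)
    telescope₁ = solve-∀ ℚ-ring
    regroup : ∀ a b c i → a * b * - (c * i) ≡ - (c * a) * (i * b)
    regroup = solve-∀ ℚ-ring
    index : ∀ k → 3 ℕ.+ (4 ℕ.* k ℕ.+ 1) ≡ 4 ℕ.* suc k
    index = ℕ-solve-∀
  quad·γ k 2 =
    trans (cong (fromℕ (3 ℕ.+ (4 ℕ.* k ℕ.+ 2)) *_)
                (telescope₂ (threeQuarters * H (suc k)) (σ₀ (suc k)) (σ₁ (suc k)) (σ₂ (suc k)) (inv (4 ℕ.* suc k))))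
          (fromℕ*inv≡1 (4 ℕ.* suc k) (index k))
    where
    telescope₂ : ∀ h a₀ a₁ a₂ d → h + (a₀ + d) + - (h + a₂) + (a₂ - a₁) + (a₁ - a₀) ≡ d
    telescope₂ = solve-∀ ℚ-ring
    index : ∀ k → 3 ℕ.+ (4 ℕ.* k ℕ.+ 2) ≡ suc (4 ℕ.* suc k)
    index = ℕ-solve-∀
  quad·γ k 3 =
    trans (cong (fromℕ (3 ℕ.+ (4 ℕ.* k ℕ.+ 3)) *_)
                (telescope₃ (threeQuarters * H (suc k)) (σ₀ (suc (suc k))) (σ₁ (suc k)) (σ₂ (suc k))
                            (inv (4 ℕ.* suc k ℕ.+ 1))))
          (fromℕ*inv≡1 (4 ℕ.* suc k ℕ.+ 1) (index k))
    where
    telescope₃ : ∀ h a₀ a₁ a₂ d → (a₁ + d) - a₀ + (h + a₀) + - (h + a₂) + (a₂ - a₁) ≡ d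
    telescope₃ = solve-∀ ℚ-ring
    index : ∀ k → 3 ℕ.+ (4 ℕ.* k ℕ.+ 3) ≡ suc (4 ℕ.* suc k ℕ.+ 1)
    index = ℕ-solve-∀
  quad·γ k (suc (suc (suc (suc t)))) =
    trans (cong (λ n → fromℕ n * (quad· γ (suc k)) t) (index k t)) (quad·γ (suc k) t)
    where
    index : ∀ k t → 3 ℕ.+ (4 ℕ.* k ℕ.+ (4 ℕ.+ t)) ≡ 3 ℕ.+ (4 ℕ.* suc k ℕ.+ t)
    index = ℕ-solve-∀

  pad₆ : (ℕ → ℚ) → ℕ → ℚ
  pad₆ u (suc (suc (suc (suc (suc (suc j)))))) = u j
  pad₆ u _                                      = 0ℚ

  quad·pad₆β : ∀ s → (quad· pad₆ β) (4 ℕ.+ s) ≡ 0ℚ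
  quad·pad₆β 0 = refl
  quad·pad₆β 1 = refl
  quad·pad₆β (suc (suc t)) = quad·β t

  quad·pad₆γ : ∀ s → fromℕ (suc s) * (quad· pad₆ (γ 0)) (4 ℕ.+ s) ≡ (quad′· pad₆ β) (4 ℕ.+ s)
  quad·pad₆γ 0 = refl
  quad·pad₆γ 1 = refl
  quad·pad₆γ (suc (suc t)) = quad·γ 0 t

module PIntegral (p : ℕ) (p-prime : Prime p) where
  open import Data.Nat.Divisibility
    using (_∣_; divides; _∣0; ∣1⇒≡1; m*n∣⇒m∣; *-cancelˡ-∣; ∣m⇒∣m*n; ∣n⇒∣m*n; >⇒∤)
  import Data.Nat.Properties as ℕ
  open import Data.Nat.Primality using (euclidsLemma; ¬prime[1]; prime⇒nonZero)
  open import Data.Integer as ℤ using (+_)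
  open import Data.Integer.Properties using (abs-*)
  import Data.Integer.Divisibility.Signed as ℤ∣
  open import Data.Rational using (ℚ; 0ℚ; _+_; _*_; _-_; -_; ↥_; ↧_; _/_)
  open import Data.Rational.Properties using (↥-+; ↧-+; ↥-*; ↧-*; ↥-/; ↧-/; ↧-neg; *-comm)
  open import Data.Sum using (inj₁; inj₂)
  open import Relation.Nullary using (¬_; contradiction)
  open RationalArithmetic using (inv-cancelˡ)

  private instance
    p≢0 : NonZero p
    p≢0 = prime⇒nonZero p-prime

  record Integral (x : ℚ) : Set where
    constructor integral
    field p∤↧ : ¬ p ∣ ℤ.∣ ↧ x ∣

  record p²∣_ (x : ℚ) : Set where
    constructor p²-divides
    field
      p²∣↥      : p ℕ.* p ∣ ℤ.∣ ↥ x ∣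
      integral′ : Integral x

  p∤1 : ¬ p ∣ 1
  p∤1 p∣1 = ¬prime[1] (subst Prime (∣1⇒≡1 p∣1) p-prime)

  p∤* : ∀ {a b} → ¬ p ∣ a → ¬ p ∣ b → ¬ p ∣ a ℕ.* b
  p∤* {a} {b} p∤a p∤b p∣ab with euclidsLemma a b p-prime p∣ab
  ... | inj₁ p∣a = p∤a p∣a
  ... | inj₂ p∣b = p∤b p∣b

  p²∣*⇒p²∣ : ∀ {a b} → ¬ p ∣ b → p ℕ.* p ∣ a ℕ.* b → p ℕ.* p ∣ a
  p²∣*⇒p²∣ {a} {b} p∤b p²∣ab with euclidsLemma a b p-prime (m*n∣⇒m∣ p p p²∣ab)
  ... | inj₂ p∣b = contradiction p∣b p∤b
  ... | inj₁ (divides q refl) with euclidsLemma q b p-prime (*-cancelˡ-∣ p (subst (p ℕ.* p ∣_) reassoc p²∣ab))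
    where
    reassoc : q ℕ.* p ℕ.* b ≡ p ℕ.* (q ℕ.* b)
    reassoc = trans (cong (ℕ._* b) (ℕ.*-comm q p)) (ℕ.*-assoc p q b)
  ... | inj₂ p∣b = contradiction p∣b p∤b
  ... | inj₁ (divides q′ refl) = divides q′ (ℕ.*-assoc q′ p p)

  -- ↥-+, ↧-+, ↥-*, … present a normalised x as the fraction (↥ x · g) / (↧ x · g).
  integral-from-fraction : ∀ x g {d} → ↧ x ℤ.* g ≡ d → ¬ p ∣ ℤ.∣ d ∣ → Integral x
  integral-from-fraction x g refl p∤d =
    integral λ p∣↧x → p∤d (subst (p ∣_) (sym (abs-* (↧ x) g)) (∣m⇒∣m*n ℤ.∣ g ∣ p∣↧x))

  p²∣-from-fraction : ∀ x g {n d} → ↥ x ℤ.* g ≡ n → ↧ x ℤ.* g ≡ d → ¬ p ∣ ℤ.∣ d ∣ → p ℕ.* p ∣ ℤ.∣ n ∣ → p²∣ x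
  p²∣-from-fraction x g refl refl p∤d p²∣n =
    p²-divides (p²∣*⇒p²∣ p∤g (subst (p ℕ.* p ∣_) (abs-* (↥ x) g) p²∣n)) (integral-from-fraction x g refl p∤d)
    where
    p∤g : ¬ p ∣ ℤ.∣ g ∣
    p∤g p∣g = p∤d (subst (p ∣_) (sym (abs-* (↧ x) g)) (∣n⇒∣m*n ℤ.∣ ↧ x ∣ p∣g))

  p∤↧*↧ : ∀ {a b} → Integral a → Integral b → ¬ p ∣ ℤ.∣ ↧ a ℤ.* ↧ b ∣
  p∤↧*↧ {a} {b} (integral p∤↧a) (integral p∤↧b) =
    subst (λ n → ¬ p ∣ n) (sym (abs-* (↧ a) (↧ b))) (p∤* p∤↧a p∤↧b)

  integral-+ : ∀ {a b} → Integral a → Integral b → Integral (a + b)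
  integral-+ {a} {b} ia ib = integral-from-fraction (a + b) _ (↧-+ a b) (p∤↧*↧ ia ib)

  integral-* : ∀ {a b} → Integral a → Integral b → Integral (a * b)
  integral-* {a} {b} ia ib = integral-from-fraction (a * b) _ (↧-* a b) (p∤↧*↧ ia ib)

  integral-neg : ∀ {a} → Integral a → Integral (- a)
  integral-neg {a} (integral p∤↧a) = integral (subst (λ d → ¬ p ∣ ℤ.∣ d ∣) (sym (↧-neg a)) p∤↧a)

  integral-/ : ∀ i n .{{_ : NonZero n}} → ¬ p ∣ n → Integral (i / n)
  integral-/ i n = integral-from-fraction (i / n) _ (↧-/ i n)

  integral-fromℕ : ∀ n → Integral (fromℕ n)
  integral-fromℕ n = integral-/ (+ n) 1 p∤1

  integral-inv : ∀ {n} → suc n < p → Integral (inv n)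
  integral-inv {n} n<p = integral-/ (+ 1) (suc n) (>⇒∤ n<p)

  p²∣-/ : ∀ i n .{{_ : NonZero n}} → ¬ p ∣ n → p ℕ.* p ∣ ℤ.∣ i ∣ → p²∣ (i / n)
  p²∣-/ i n = p²∣-from-fraction (i / n) _ (↥-/ i n) (↧-/ i n)

  p²∣-fromℕ : ∀ {n} → p ℕ.* p ∣ n → p²∣ fromℕ n
  p²∣-fromℕ {n} = p²∣-/ (+ n) 1 p∤1

  p²∣-+ : ∀ {a b} → p²∣ a → p²∣ b → p²∣ (a + b)
  p²∣-+ {a} {b} (p²-divides p²∣↥a ia) (p²-divides p²∣↥b ib) =
    p²∣-from-fraction (a + b) _ (↥-+ a b) (↧-+ a b) (p∤↧*↧ ia ib)
      (ℤ∣.∣⇒∣ᵤ (ℤ∣.∣m∣n⇒∣m+n (ℤ∣.∣m⇒∣m*n (↧ b) (signed (↥ a) p²∣↥a)) (ℤ∣.∣m⇒∣m*n (↧ a) (signed (↥ b) p²∣↥b))))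
    where
    signed : ∀ i → p ℕ.* p ∣ ℤ.∣ i ∣ → + (p ℕ.* p) ℤ∣.∣ i
    signed i = ℤ∣.∣ᵤ⇒∣ {+ (p ℕ.* p)} {i}

  p²∣-* : ∀ {c a} → Integral c → p²∣ a → p²∣ (c * a)
  p²∣-* {c} {a} ic (p²-divides p²∣↥a ia) =
    p²∣-from-fraction (c * a) _ (↥-* c a) (↧-* c a) (p∤↧*↧ ic ia)
      (subst (p ℕ.* p ∣_) (sym (abs-* (↥ c) (↥ a))) (∣n⇒∣m*n ℤ.∣ ↥ c ∣ p²∣↥a))

  integral-*-cancelˡ : ∀ {s x} → suc s < p → Integral (fromℕ (suc s) * x) → Integral x
  integral-*-cancelˡ {s} {x} s<p i = subst Integral (inv-cancelˡ s x) (integral-* (integral-inv s<p) i)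

  p²∣-*-cancelˡ : ∀ {s x} → suc s < p → p²∣ (fromℕ (suc s) * x) → p²∣ x
  p²∣-*-cancelˡ {s} {x} s<p d = subst p²∣_ (inv-cancelˡ s x) (p²∣-* (integral-inv s<p) d)

  integral-- : ∀ {a b} → Integral a → Integral b → Integral (a - b)
  integral-- ia ib = integral-+ ia (integral-neg ib)

  p²∣-*ʳ : ∀ {a c} → p²∣ a → Integral c → p²∣ (a * c)
  p²∣-*ʳ {a} {c} d ic = subst p²∣_ (*-comm c a) (p²∣-* ic d)

  p²∣0 : p²∣ 0ℚ
  p²∣0 = p²∣-fromℕ ((p ℕ.* p) ∣0)

  p²∣⇒CongMod : ∀ a b → p²∣ (a - b) → CongMod p (p ℕ.* p) a b
  p²∣⇒CongMod a b (p²-divides p²∣↥ (integral p∤↧)) = p²∣↥ , p∤↧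

three-term-induction : ∀ {ℓ} (P : ℕ → Set ℓ) n → P 0 → P 1 → P 2 →
  (∀ s → suc s < n → P s → P (1 ℕ.+ s) → P (2 ℕ.+ s) → P (3 ℕ.+ s)) →
  ∀ s → s < n → P s × P (1 ℕ.+ s) × P (2 ℕ.+ s)
three-term-induction P n P₀ P₁ P₂ step zero    _   = P₀ , P₁ , P₂
three-term-induction P n P₀ P₁ P₂ step (suc s) s<n =
  let Pₛ , P₁₊ₛ , P₂₊ₛ = three-term-induction P n P₀ P₁ P₂ step s (<-trans (n<1+n s) s<n)
  in  P₁₊ₛ , P₂₊ₛ , step s s<n Pₛ P₁₊ₛ P₂₊ₛ

module Congruence (p : ℕ) (p-prime : Prime p) where
  open import Data.Nat.Divisibility using (_∣_; *-pres-∣)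
  open import Data.Rational using (ℚ; 0ℚ; 1ℚ; _+_; _*_; _-_)
  open RationalArithmetic
  open QuadrinomialRecurrence
  open HarmonicCandidate
  open PIntegral p p-prime

  integral-quad′· : ∀ u i → Integral (u (2 ℕ.+ i)) → Integral (u (1 ℕ.+ i)) → Integral (u i) → Integral ((quad′· u) i)
  integral-quad′· u i i₂ i₁ i₀ =
    integral-+ (integral-+ i₂ (integral-* (integral-fromℕ 2) i₁)) (integral-* (integral-fromℕ 3) i₀)

  integral-β : ∀ t → Integral (β t)
  integral-β 0 = integral p∤1
  integral-β 1 = integral p∤1
  integral-β 2 = integral p∤1
  integral-β 3 = integral p∤1
  integral-β (suc (suc (suc (suc t)))) = integral-β t

  integral-pad₆β : ∀ j → Integral (pad₆ β j)
  integral-pad₆β (suc (suc (suc (suc (suc (suc j)))))) = integral-β j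
  integral-pad₆β 0 = integral p∤1
  integral-pad₆β 1 = integral p∤1
  integral-pad₆β 2 = integral p∤1
  integral-pad₆β 3 = integral p∤1
  integral-pad₆β 4 = integral p∤1
  integral-pad₆β 5 = integral p∤1

  -- Integrality of γ is read off quad·pad₆γ, since s + 1 is a unit and β is integral.
  integral-pad₆γ : ∀ s → s < p →
    Integral (pad₆ (γ 0) (4 ℕ.+ s)) × Integral (pad₆ (γ 0) (5 ℕ.+ s)) × Integral (pad₆ (γ 0) (6 ℕ.+ s))
  integral-pad₆γ = three-term-induction (λ s → Integral (pad₆ (γ 0) (4 ℕ.+ s))) p (integral p∤1) (integral p∤1) (integral p∤1) step
    where
    g = pad₆ (γ 0)
    isolate : ∀ a b c d → a ≡ a + b + c + d - b - c - d
    isolate = solve-∀ ℚ-ring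
    step : ∀ s → suc s < p → Integral (g (4 ℕ.+ s)) → Integral (g (5 ℕ.+ s)) → Integral (g (6 ℕ.+ s)) → Integral (g (7 ℕ.+ s))
    step s s<p i₄ i₅ i₆ =
      subst Integral (sym (isolate (g (7 ℕ.+ s)) (g (6 ℕ.+ s)) (g (5 ℕ.+ s)) (g (4 ℕ.+ s))))
        (integral-+ (integral-+ (integral-+ integral-window (integral-neg i₆)) (integral-neg i₅)) (integral-neg i₄))
      where
      integral-window : Integral ((quad· g) (4 ℕ.+ s))
      integral-window = integral-*-cancelˡ s<p (subst Integral (sym (quad·pad₆γ s))
        (integral-quad′· (pad₆ β) (4 ℕ.+ s) (integral-pad₆β (6 ℕ.+ s)) (integral-pad₆β (5 ℕ.+ s)) (integral-pad₆β (4 ℕ.+ s))))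

  quadBinom-congruence : ∀ m → p ∣ suc m → ∀ r → r < p →
    p²∣ (fromℕ (quadBinom m r) - (β r + fromℕ (suc m) * γ 0 r))
  quadBinom-congruence m p∣N r r<p =
    proj₂ (proj₂ (three-term-induction (λ s → p²∣ e (4 ℕ.+ s)) p p²∣padding p²∣padding p²∣e₆ step r r<p))
    where
    N = fromℕ (suc m)
    x = quadBinom₆ m
    b = pad₆ β
    g = pad₆ (γ 0)
    e : ℕ → ℚ
    e j = x j - (b j + N * g j)

    p²∣padding : p²∣ (0ℚ - (0ℚ + N * 0ℚ))
    p²∣padding = subst p²∣_ (sym (vanish N)) p²∣0
      where
      vanish : ∀ N → 0ℚ - (0ℚ + N * 0ℚ) ≡ 0ℚ
      vanish = solve-∀ ℚ-ring

    p²∣e₆ : p²∣ e 6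
    p²∣e₆ = subst p²∣_ (sym (trans (cong (λ c → fromℕ c - (1ℚ + N * 0ℚ)) (quadBinom-0 m)) (vanish N))) p²∣0
      where
      vanish : ∀ N → 1ℚ - (1ℚ + N * 0ℚ) ≡ 0ℚ
      vanish = solve-∀ ℚ-ring

    p²∣N*N : p²∣ (N * N)
    p²∣N*N = subst p²∣_ (fromℕ-* (suc m) (suc m)) (p²∣-fromℕ (*-pres-∣ p∣N p∣N))

    x-recurrence : ∀ s → recurrenceDefect N (fromℕ (suc s)) x (4 ℕ.+ s) ≡ 0ℚ
    x-recurrence s = trans (cong (λ S → recurrenceDefect N S x (4 ℕ.+ s)) (sym index)) (quadBinom₆-recurrence m (4 ℕ.+ s))
      where
      cancel : ∀ a b → a + b - a ≡ b
      cancel = solve-∀ ℚ-ring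
      index : fromℕ (4 ℕ.+ s) - fromℕ 3 ≡ fromℕ (suc s)
      index = trans (cong (_- fromℕ 3) (fromℕ-+ 3 (suc s))) (cancel (fromℕ 3) (fromℕ (suc s)))

    step : ∀ s → suc s < p → p²∣ e (4 ℕ.+ s) → p²∣ e (5 ℕ.+ s) → p²∣ e (6 ℕ.+ s) → p²∣ e (7 ℕ.+ s)
    step s s<p p²∣e₄ p²∣e₅ p²∣e₆ =
      let i₄ , i₅ , i₆ = integral-pad₆γ s (<-trans (n<1+n s) s<p) in
      p²∣-*-cancelˡ s<p (subst p²∣_ (sym (deviation-recurrence N S x b g (4 ℕ.+ s) (x-recurrence s) (quad·pad₆β s) (quad·pad₆γ s)))
        (p²∣-+ (p²∣-+ (p²∣-+ (p²∣-* (integral-- iN iS) p²∣e₆)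
                              (p²∣-* (integral-- (integral-* (integral-fromℕ 2) iN) iS) p²∣e₅))
                       (p²∣-* (integral-- (integral-* (integral-fromℕ 3) iN) iS) p²∣e₄))
               (p²∣-*ʳ p²∣N*N (integral-quad′· g (4 ℕ.+ s) i₆ i₅ i₄))))
      where
      S = fromℕ (suc s)
      iN = integral-fromℕ (suc m)
      iS = integral-fromℕ (suc s)

open import Data.Nat using (ℕ; suc; _≤_; _∸_; _+_; _*_)
open import Data.Nat.Primality using (Prime)
open import Data.Rational using (ℚ; 1ℚ; -_; _-_)
open import Data.Product using (_×_)
import Data.Rational as Q
open import Data.Nat using (s≤s)
open import Data.Nat.Properties using (+-identityʳ)
open import Data.Nat.Divisibility using (n∣m*n)
open import Data.Rational.Properties using (+-identityˡ; neg-distribʳ-*)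

-- Matching on 5 ≤ p only exposes p ≥ 1, so that 4k + i ≤ p ∸ 1 means 4k + i < p.
proposition1 : (p n k : ℕ) → Prime p → 5 ≤ p → 1 ≤ n → 1 ≤ k →
    (4 * k ≤ p ∸ 1 →
    CongMod p (p * p) (fromℕ (quadBinom (n * p ∸ 1) (4 * k)))
    (1ℚ - fromℕ (n * p) Q.* (threeQuarters Q.* H k Q.+ sumTo k (λ j → inv (4 * j + 2)))))
    × (4 * k + 1 ≤ p ∸ 1 →
    CongMod p (p * p) (fromℕ (quadBinom (n * p ∸ 1) (4 * k + 1)))
    (- 1ℚ Q.+ fromℕ (n * p) Q.* (threeQuarters Q.* H k Q.+ sumTo (suc k) (λ j → inv (4 * j)))))
    × (4 * k + 2 ≤ p ∸ 1 →
    CongMod p (p * p) (fromℕ (quadBinom (n * p ∸ 1) (4 * k + 2)))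
    (fromℕ (n * p) Q.* (sumTo (suc k) (λ j → inv (4 * j + 1)) - sumTo (suc k) (λ j → inv (4 * j)))))
    × (4 * k + 3 ≤ p ∸ 1 →
    CongMod p (p * p) (fromℕ (quadBinom (n * p ∸ 1) (4 * k + 3)))
    (fromℕ (n * p) Q.* (sumTo (suc k) (λ j → inv (4 * j + 2)) - sumTo (suc k) (λ j → inv (4 * j + 1)))))
proposition1 p n k p-prime (s≤s _) (s≤s _) _ =
    congruence 0 (sym (+-identityʳ (4 * k))) (cong (1ℚ Q.+_) (sym (neg-distribʳ-* N _)))
  , congruence 1 refl refl
  , congruence 2 refl (+-identityˡ _)
  , congruence 3 refl (+-identityˡ _)
  where
  open PIntegral p p-prime using (p²∣_; p²∣⇒CongMod)
  open HarmonicCandidate using (β; γ; β-periodic; γ-shift)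
  N = fromℕ (n * p)
  congruence : ∀ {r} i {c} → r ≡ 4 * k + i → β i Q.+ N Q.* γ k i ≡ c →
    r ≤ p ∸ 1 → CongMod p (p * p) (fromℕ (quadBinom (n * p ∸ 1) r)) c
  congruence i {c} refl β+Nγ≡c r≤p-1 = p²∣⇒CongMod A c (subst (λ c → p²∣ (A - c))
    (trans (cong₂ (λ b g → b Q.+ N Q.* g) (β-periodic k i) (γ-shift 0 k i)) β+Nγ≡c)
    (Congruence.quadBinom-congruence p p-prime (n * p ∸ 1) (n∣m*n n) (4 * k + i) (s≤s r≤p-1)))
    where
    A = fromℕ (quadBinom (n * p ∸ 1) (4 * k + i))
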